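{- Let $\mathbb{S}=(\mathbb{F}_q,+,\star)$ be a presemifield of even order $q$ and let $\Pi(\mathbb{S})$ be the corresponding semifield plane. Let $\mathcal{O}$ be a translation hyperoval of $\Pi(\mathbb{S})$. Then, up to the action of the full collineation group $\mathrm{Aut}(\Pi(\mathbb{S}))$, $\mathcal{O}$ can be written in one of the following forms: (a) $\mathcal{O}=\{(x,f_a(x)) : x\in\mathbb{F}_q\}\cup\{(0),(\infty)\}$, where $f_a$ is an additive permutation of $\mathbb{F}_q$ with $f_a(0)=0$; (b) $\mathcal{O}=\{(f_b(y),y): y\in\mathbb{F}_q\}\cup\{(0),(\alpha)\}$, where $\alpha\in\mathbb{F}_q^*$ and $f_b$ is a two-to-one additive map on $\mathbb{F}_q$ with $f_b(0)=0$.
   Context: A presemifield $(\mathbb{S},+,\star)$ of order $q=2^n$ is taken with underlying set $\mathbb{F}_q$, addition the field addition, and a multiplication $\star$ that is left and right distributive over $+$ and has no zero divisors. The semifield plane $\Pi(\mathbb{S})$ has affine points $(a,b)$, $a,b\in\mathbb{F}_q$, and points at infinity $(a)$, $a\in\mathbb{F}_q\cup\{\infty\}$. Its lines are: the line at infinity $l_\infty$ consisting of all points $(a)$; for $a\in\mathbb{F}_q$ the line $l_a=\{(a,y): y\in\mathbb{F}_q\}\cup\{(\infty)\}$; and for $a,b\in\mathbb{F}_q$ the line $l_{a,b}=\{(x,y): y=x\star a+b\}\cup\{(a)\}$. A hyperoval is a set of $q+2$ points no three of which are collinear; a line meeting it in $2$ points is a secant. The translation group consists of the collineations $(x,y)\mapsto(x+a,y+b)$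 fixing every point at infinity. A hyperoval $\mathcal{O}$ is a translation hyperoval if $l_\infty$ is secant to $\mathcal{O}$ and some subgroup of order $q$ of the translation group acts regularly on the $q$ affine points of $\mathcal{O}$. -}

module Defs where

open import Data.Nat using (ℕ; _+_; _^_; _≤_)
open import Data.Bool using (Bool; false; _xor_)
open import Data.Vec using (Vec; zipWith; replicate)
open import Data.Maybe using (Maybe; just; nothing)
open import Data.List using (List; length)
open import Data.List.Membership.Propositional using (_∈_)
open import Data.List.Relation.Unary.Unique.Propositional using (Unique)
open import Data.Product using (Σ; ∃; _×_; _,_; proj₁; proj₂)
open import Data.Sum using (_⊎_)
open import Relation.Binary.PropositionalEquality using (_≡_)
open import Relation.Nullary using (¬_)
open import Function.Bundles using (_⇔_)

-- The additive group (F_q , +) with q = 2^n, realised as F_2^n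
-- (vectors of bits with componentwise xor).  Only the additive
-- structure of F_q enters the statement.

𝔽 : ℕ → Set
𝔽 n = Vec Bool n

infixl 6 _⊕_
_⊕_ : ∀ {n} → 𝔽 n → 𝔽 n → 𝔽 n
_⊕_ = zipWith _xor_

𝟎 : ∀ {n} → 𝔽 n
𝟎 = replicate _ false

HasSize : ∀ {A : Set} → (A → Set) → ℕ → Set
HasSize {A} P k =
  Σ (List A) λ xs → Unique xs × (length xs ≡ k) × (∀ x → (x ∈ xs) ⇔ P x)

record IsPresemifield {n : ℕ} (_⋆_ : 𝔽 n → 𝔽 n → 𝔽 n) : Set where
  field
    distribˡ : ∀ x y z → x ⋆ (y ⊕ z) ≡ (x ⋆ y) ⊕ (x ⋆ z)
    distribʳ : ∀ x y z → (y ⊕ z) ⋆ x ≡ (y ⋆ x) ⊕ (z ⋆ x)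
    noZeroDivisors : ∀ x y → x ⋆ y ≡ 𝟎 → (x ≡ 𝟎) ⊎ (y ≡ 𝟎)

-- aff a b = affine point (a,b);  inf (just a) = (a);  inf nothing = (∞)
data Point (n : ℕ) : Set where
  aff : 𝔽 n → 𝔽 n → Point n
  inf : Maybe (𝔽 n) → Point n

data Line (n : ℕ) : Set where
  lInf : Line n
  vert : 𝔽 n → Line n
  line : 𝔽 n → 𝔽 n → Line n

module Plane {n : ℕ} (_⋆_ : 𝔽 n → 𝔽 n → 𝔽 n) where

  _on_ : Point n → Line n → Set
  aff x y       on lInf     = Data.Empty.⊥ where import Data.Empty
  inf _         on lInf     = Data.Unit.⊤ where import Data.Unit
  aff x y       on vert a   = x ≡ a
  inf nothing   on vert a   = Data.Unit.⊤ where import Data.Unit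
  inf (just _)  on vert a   = Data.Empty.⊥ where import Data.Empty
  aff x y       on line a b = y ≡ (x ⋆ a) ⊕ b
  inf nothing   on line a b = Data.Empty.⊥ where import Data.Empty
  inf (just c)  on line a b = c ≡ a

  record Collineation : Set where
    field
      pt     : Point n → Point n
      ptInv  : Point n → Point n
      pt-inv₁ : ∀ p → pt (ptInv p) ≡ p
      pt-inv₂ : ∀ p → ptInv (pt p) ≡ p
      ln     : Line n → Line n
      lnInv  : Line n → Line n
      ln-inv₁ : ∀ l → ln (lnInv l) ≡ l
      ln-inv₂ : ∀ l → lnInv (ln l) ≡ l
      preserves : ∀ p l → (p on l) ⇔ (pt p on ln l)

  PointSet : Set₁
  PointSet = Point n → Set

  IsHyperoval : PointSet → Set
  IsHyperoval O =
    HasSize O (2 ^ n + 2) ×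
    (∀ l p₁ p₂ p₃ → O p₁ → O p₂ → O p₃ → p₁ on l → p₂ on l → p₃ on l →
       ¬ p₁ ≡ p₂ → ¬ p₁ ≡ p₃ → ¬ p₂ ≡ p₃ → Data.Empty.⊥)
    where import Data.Empty

  IsSecant : PointSet → Line n → Set
  IsSecant O l = HasSize (λ p → O p × p on l) 2

  Translation : Set
  Translation = 𝔽 n × 𝔽 n

  translate : Translation → Point n → Point n
  translate (a , b) (aff x y) = aff (x ⊕ a) (y ⊕ b)
  translate (a , b) (inf c)   = inf c

  record IsTranslationSubgroupOfOrderQ (T : Translation → Set) : Set where
    field
      hasZero   : T (𝟎 , 𝟎)
      closed    : ∀ s t → T s → T t → T ((proj₁ s ⊕ proj₁ t) , (proj₂ s ⊕ proj₂ t))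
      order     : HasSize T (2 ^ n)

  ActsRegularlyOnAffine : (Translation → Set) → PointSet → Set
  ActsRegularlyOnAffine T O =
    (∀ t x y → T t → O (aff x y) → O (translate t (aff x y))) ×
    (∀ x y x' y' → O (aff x y) → O (aff x' y') →
       Σ Translation λ t → T t × translate t (aff x y) ≡ aff x' y' ×
         (∀ t' → T t' → translate t' (aff x y) ≡ aff x' y' → t' ≡ t))

  IsTranslationHyperoval : PointSet → Set₁
  IsTranslationHyperoval O =
    IsHyperoval O × IsSecant O lInf ×
    Σ (Translation → Set) λ T → IsTranslationSubgroupOfOrderQ T × ActsRegularlyOnAffine T O

  image : Collineation → PointSet → PointSet
  image g O p = O (Collineation.ptInv g p)

  _≐_ : PointSet → PointSet → Set
  A ≐ B = ∀ p → A p ⇔ B p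

IsAdditive : ∀ {n} → (𝔽 n → 𝔽 n) → Set
IsAdditive f = ∀ x y → f (x ⊕ y) ≡ f x ⊕ f y

IsPermutation : ∀ {n} → (𝔽 n → 𝔽 n) → Set
IsPermutation {n} f = Σ (𝔽 n → 𝔽 n) λ g → (∀ x → g (f x) ≡ x) × (∀ y → f (g y) ≡ y)

IsTwoToOne : ∀ {n} → (𝔽 n → 𝔽 n) → Set
IsTwoToOne f = ∀ z → HasSize (λ x → f x ≡ z) 0 ⊎ HasSize (λ x → f x ≡ z) 2

FormA : ∀ {n} → (𝔽 n → 𝔽 n) → Point n → Set
FormA f p = (∃ λ x → p ≡ aff x (f x)) ⊎ (p ≡ inf (just 𝟎)) ⊎ (p ≡ inf nothing)

FormB : ∀ {n} → (𝔽 n → 𝔽 n) → 𝔽 n → Point n → Set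
FormB f α p = (∃ λ y → p ≡ aff (f y) y) ⊎ (p ≡ inf (just 𝟎)) ⊎ (p ≡ inf (just α))

-- Translating an affine point of O to the origin and shearing, by (x, y) ↦ (x, y + x ⋆ s), a point
-- (a) of O at infinity to (0) turns the affine part of O into a sheared copy of the translation
-- group, i.e. an additive subgroup of order q.  If (∞) ∈ O, each vertical line meets this subgroup
-- once, so it is the graph of an additive f, injective because (x, 0), (0, 0) and (0) are collinear.
-- Otherwise O ∩ l∞ = {(0), (α)} and each horizontal line meets the subgroup once, so it is
-- {(k y, y)} with k additive; the vertical line through the origin bounds the kernel of k by two
-- elements, and counting the slopes of the lines through the origin shows it is not trivial.

module Submission where

open import Level using (0ℓ)
open import Data.Nat using (ℕ; zero; suc; _+_; _^_; _≤_; z≤n; s≤s)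
open import Data.Nat.Properties using (≤-trans; ≤-reflexive; <⇒≱; +-identityʳ; +-monoˡ-≤; m^n>0)
open import Data.Bool using (true; false)
open import Data.Bool.Properties
  using (xor-assoc; xor-comm; xor-identityˡ; xor-identityʳ; xor-same)
  renaming (_≟_ to _≟ᴮ_)
open import Data.Vec using ([]; _∷_)
open import Data.Vec.Properties
  using (zipWith-assoc; zipWith-comm; zipWith-identityˡ; zipWith-identityʳ; ∷-injective)
  renaming (≡-dec to ≡-dec-Vec)
open import Data.Maybe using (Maybe; just; nothing)
import Data.Maybe as Maybe
open import Data.Maybe.Properties using () renaming (≡-dec to ≡-dec-Maybe)
open import Data.List using (List; []; _∷_; length; map; _++_)
open import Data.List.Properties using (length-++; length-map; length-removeAt′)
open import Data.List.Membership.Propositional using (_∈_; _─_; find; lose)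
open import Data.List.Membership.Propositional.Properties using (∈-map⁺; ∈-map⁻; ∈-++⁺ˡ; ∈-++⁺ʳ)
open import Data.List.Relation.Unary.Any using (here; there; any?)
import Data.List.Relation.Unary.All as All
open import Data.List.Relation.Unary.Unique.Propositional using (Unique; []; _∷_)
open import Data.List.Relation.Unary.Unique.Propositional.Properties using (map⁺; ++⁺)
open import Data.Product using (Σ; ∃; ∃₂; _×_; _,_; proj₁; proj₂; uncurry)
open import Data.Product.Algebra using (×-comm)
open import Data.Sum using (_⊎_; inj₁; inj₂; [_,_]′)
import Data.Sum as Sum
open import Data.Unit using (⊤; tt)
open import Data.Empty using (⊥; ⊥-elim)
open import Algebra.Bundles using (AbelianGroup)
open import Algebra.Structures using (IsAbelianGroup)
open import Algebra.Definitions using (Involutive)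
open import Function.Base using (id; _∘_)
open import Function.Bundles using (_⇔_; mk⇔; Equivalence; _↔_; Inverse; mk↔ₛ′)
open import Relation.Binary.Definitions using (DecidableEquality)
open import Relation.Binary.PropositionalEquality
open import Relation.Nullary using (¬_; Dec; yes; no; contradiction)
open import Relation.Nullary.Decidable using (map′; ¬?; _×-dec_; decidable-stable)
open import Relation.Unary using (Decidable)
open import Defs

private variable
  n m : ℕ
  A B : Set

open Equivalence using (to; from)

∈-─ : ∀ {x y : A} {ys} (y∈ys : y ∈ ys) → x ∈ ys → y ≢ x → x ∈ ys ─ y∈ys
∈-─ (here refl)  (here refl)  y≢x = ⊥-elim (y≢x refl)
∈-─ (here refl)  (there x∈ys) _   = x∈ys
∈-─ (there _)    (here refl)  _   = here refl
∈-─ (there y∈ys) (there x∈ys) y≢x = there (∈-─ y∈ys x∈ys y≢x)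

injectiveOn⇒length≤ : (g : A → B) {xs : List A} {ys : List B} → Unique xs →
  (∀ {x y} → x ∈ xs → y ∈ xs → g x ≡ g y → x ≡ y) →
  (∀ {x} → x ∈ xs → g x ∈ ys) → length xs ≤ length ys
injectiveOn⇒length≤ g [] _ _ = z≤n
injectiveOn⇒length≤ g {x ∷ xs} {ys} (x∉xs ∷ unique) injective into =
  ≤-trans (s≤s (injectiveOn⇒length≤ g unique injective′ into′))
          (≤-reflexive (sym (length-removeAt′ ys _)))
  where
  gx∈ys : g x ∈ ys
  gx∈ys = into (here refl)
  injective′ : ∀ {y z} → y ∈ xs → z ∈ xs → g y ≡ g z → y ≡ z
  injective′ y∈xs z∈xs = injective (there y∈xs) (there z∈xs)
  into′ : ∀ {y} → y ∈ xs → g y ∈ ys ─ gx∈ys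
  into′ y∈xs = ∈-─ gx∈ys (into (there y∈xs))
    (λ gx≡gy → All.lookup x∉xs y∈xs (injective (here refl) (there y∈xs) gx≡gy))

injectiveOn⇒surjective : DecidableEquality B → {P : A → Set} →
  HasSize (λ (_ : B) → ⊤) m → HasSize P m →
  (g : A → B) → (∀ {x y} → P x → P y → g x ≡ g y → x ≡ y) →
  ∀ b → ∃ λ x → P x × g x ≡ b
injectiveOn⇒surjective _≟_ (bs , _ , bs-length , bs-all) (xs , unique , xs-length , xs-P) g injective b
  with any? (λ x → g x ≟ b) xs
... | yes hit = let x , x∈xs , gx≡b = find hit in x , to (xs-P x) x∈xs , gx≡b
... | no miss = contradiction xs≤bs─b (<⇒≱ bs─b<xs)
  where
  b∈bs : b ∈ bs
  b∈bs = from (bs-all b) tt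
  bs─b<xs : suc (length (bs ─ b∈bs)) ≤ length xs
  bs─b<xs = ≤-reflexive (trans (sym (length-removeAt′ bs _)) (trans bs-length (sym xs-length)))
  xs≤bs─b : length xs ≤ length (bs ─ b∈bs)
  xs≤bs─b = injectiveOn⇒length≤ g unique
    (λ {x} {y} x∈xs y∈xs → injective (to (xs-P x) x∈xs) (to (xs-P y) y∈xs))
    (λ {x} x∈xs → ∈-─ b∈bs (from (bs-all (g x)) tt) (λ b≡gx → miss (lose x∈xs (sym b≡gx))))

HasSize-↔ : {P : A → Set} {Q : B → Set} (A↔B : A ↔ B) →
  (∀ x → P x ⇔ Q (Inverse.to A↔B x)) → HasSize P m → HasSize Q m
HasSize-↔ {Q = Q} A↔B P⇔Q (xs , unique , xs-length , xs-P) =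
  map f xs , map⁺ f-injective unique , trans (length-map f xs) xs-length ,
  λ y → mk⇔ (into y) (onto y)
  where
  open Inverse A↔B using (strictlyInverseˡ; strictlyInverseʳ) renaming (to to f; from to f⁻¹)
  f-injective : ∀ {x x′} → f x ≡ f x′ → x ≡ x′
  f-injective {x} {x′} eq = trans (sym (strictlyInverseʳ x)) (trans (cong f⁻¹ eq) (strictlyInverseʳ x′))
  into : ∀ y → y ∈ map f xs → Q y
  into y y∈ with ∈-map⁻ f y∈
  ... | x , x∈xs , refl = to (P⇔Q x) (to (xs-P x) x∈xs)
  onto : ∀ y → Q y → y ∈ map f xs
  onto y Qy = subst (_∈ map f xs) (strictlyInverseˡ y)
    (∈-map⁺ f (from (xs-P (f⁻¹ y)) (from (P⇔Q (f⁻¹ y)) (subst Q (sym (strictlyInverseˡ y)) Qy))))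

enumeration : ∀ n → List (𝔽 n)
enumeration zero    = [] ∷ []
enumeration (suc n) = map (true ∷_) (enumeration n) ++ map (false ∷_) (enumeration n)

∈-enumeration : (v : 𝔽 n) → v ∈ enumeration n
∈-enumeration []          = here refl
∈-enumeration (true ∷ v)  = ∈-++⁺ˡ (∈-map⁺ (true ∷_) (∈-enumeration v))
∈-enumeration (false ∷ v) = ∈-++⁺ʳ _ (∈-map⁺ (false ∷_) (∈-enumeration v))

enumeration-unique : ∀ n → Unique (enumeration n)
enumeration-unique zero    = All.[] ∷ []
enumeration-unique (suc n) =
  ++⁺ (map⁺ (proj₂ ∘ ∷-injective) (enumeration-unique n))
      (map⁺ (proj₂ ∘ ∷-injective) (enumeration-unique n))
      disjoint
  where
  disjoint : ∀ {v} → ¬ (v ∈ map (true ∷_) (enumeration n) × v ∈ map (false ∷_) (enumeration n))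
  disjoint (v∈ , v∈′) with ∈-map⁻ (true ∷_) v∈ | ∈-map⁻ (false ∷_) v∈′
  ... | _ , _ , refl | _ , _ , ()

length-enumeration : ∀ n → length (enumeration n) ≡ 2 ^ n
length-enumeration zero    = refl
length-enumeration (suc n) = begin
  length (map (true ∷_) (enumeration n) ++ map (false ∷_) (enumeration n))
    ≡⟨ length-++ (map (true ∷_) (enumeration n)) ⟩
  length (map (true ∷_) (enumeration n)) + length (map (false ∷_) (enumeration n))
    ≡⟨ cong₂ _+_ (length-map _ (enumeration n)) (length-map _ (enumeration n)) ⟩
  length (enumeration n) + length (enumeration n)
    ≡⟨ cong₂ _+_ (length-enumeration n) (trans (length-enumeration n) (sym (+-identityʳ _))) ⟩
  2 ^ n + (2 ^ n + 0) ∎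
  where open ≡-Reasoning

𝔽-size : ∀ n → HasSize (λ (_ : 𝔽 n) → ⊤) (2 ^ n)
𝔽-size n = enumeration n , enumeration-unique n , length-enumeration n ,
           λ v → mk⇔ _ (λ _ → ∈-enumeration v)

∃?-𝔽 : {P : 𝔽 n → Set} → Decidable P → Dec (∃ P)
∃?-𝔽 {n} P? = map′ (λ hit → let v , _ , Pv = find hit in v , Pv)
                   (λ (v , Pv) → lose (∈-enumeration v) Pv)
                   (any? P? (enumeration n))

_≟_ : DecidableEquality (𝔽 n)
_≟_ = ≡-dec-Vec _≟ᴮ_

⊕-self : (x : 𝔽 n) → x ⊕ x ≡ 𝟎
⊕-self []      = refl
⊕-self (b ∷ x) = cong₂ _∷_ (xor-same b) (⊕-self x)

-- Characteristic two: every element is its own additive inverse.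
⊕-isAbelianGroup : IsAbelianGroup _≡_ (_⊕_ {n}) 𝟎 id
⊕-isAbelianGroup = record
  { isGroup = record
    { isMonoid = record
      { isSemigroup = record
        { isMagma = record { isEquivalence = isEquivalence ; ∙-cong = cong₂ _⊕_ }
        ; assoc   = zipWith-assoc xor-assoc }
      ; identity = zipWith-identityˡ xor-identityˡ , zipWith-identityʳ xor-identityʳ }
    ; inverse = ⊕-self , ⊕-self
    ; ⁻¹-cong = id }
  ; comm = zipWith-comm xor-comm }

⊕-abelianGroup : ℕ → AbelianGroup 0ℓ 0ℓ
⊕-abelianGroup n = record { isAbelianGroup = ⊕-isAbelianGroup {n} }

module _ {n : ℕ} where
  open AbelianGroup (⊕-abelianGroup n) public
    using () renaming (comm to ⊕-comm; identityˡ to ⊕-identityˡ; identityʳ to ⊕-identityʳ)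
  open import Algebra.Properties.AbelianGroup (⊕-abelianGroup n) public
    using (∙-cancelˡ; inverseˡ-unique; identityʳ-unique; x≈z//y; //-rightDividesʳ; \\-leftDividesʳ)
  open import Algebra.Properties.CommutativeSemigroup
    (AbelianGroup.commutativeSemigroup (⊕-abelianGroup n)) public
    using (interchange; xy∙z≈xz∙y)

x⊕y⊕y≡x : (x y : 𝔽 n) → x ⊕ y ⊕ y ≡ x
x⊕y⊕y≡x x y = //-rightDividesʳ y x

x⊕[x⊕y]≡y : (x y : 𝔽 n) → x ⊕ (x ⊕ y) ≡ y
x⊕[x⊕y]≡y = \\-leftDividesʳ

additive-𝟎 : {f : 𝔽 n → 𝔽 n} → IsAdditive f → f 𝟎 ≡ 𝟎
additive-𝟎 {f = f} additive = begin
  f 𝟎         ≡⟨ cong f (⊕-self 𝟎) ⟨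
  f (𝟎 ⊕ 𝟎)   ≡⟨ additive 𝟎 𝟎 ⟩
  f 𝟎 ⊕ f 𝟎   ≡⟨ ⊕-self (f 𝟎) ⟩
  𝟎           ∎
  where open ≡-Reasoning

additive-injective : {f : 𝔽 n → 𝔽 n} → IsAdditive f → (∀ {x} → f x ≡ 𝟎 → x ≡ 𝟎) →
  ∀ {x y} → f x ≡ f y → x ≡ y
additive-injective {f = f} additive trivial-kernel {x} {y} fx≡fy =
  inverseˡ-unique x y (trivial-kernel (trans (additive x y) (trans (cong (_⊕ f y) fx≡fy) (⊕-self (f y)))))

injective⇒surjective : (f : 𝔽 n → 𝔽 n) → (∀ {x y} → f x ≡ f y → x ≡ y) → ∀ y → ∃ λ x → f x ≡ y
injective⇒surjective {n} f injective y =
  let x , _ , fx≡y = injectiveOn⇒surjective _≟_ (𝔽-size n) (𝔽-size n) f (λ _ _ → injective) y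
  in x , fx≡y

injective⇒IsPermutation : ∀ {n} {f : 𝔽 n → 𝔽 n} → (∀ {x y} → f x ≡ f y → x ≡ y) → IsPermutation f
injective⇒IsPermutation {n} {f} injective =
  f⁻¹ , (λ x → injective (f∘f⁻¹ (f x))) , f∘f⁻¹
  where
  f⁻¹ : 𝔽 n → 𝔽 n
  f⁻¹ y = proj₁ (injective⇒surjective f injective y)
  f∘f⁻¹ : ∀ y → f (f⁻¹ y) ≡ y
  f∘f⁻¹ y = proj₂ (injective⇒surjective f injective y)

-- The fibre of z is empty, or a coset y ⊕ {𝟎 , e} of the kernel.
additive-kernel₂⇒IsTwoToOne : {f : 𝔽 n → 𝔽 n} {e : 𝔽 n} → IsAdditive f → e ≢ 𝟎 → f e ≡ 𝟎 →
  (∀ {w} → f w ≡ 𝟎 → w ≡ 𝟎 ⊎ w ≡ e) → IsTwoToOne f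
additive-kernel₂⇒IsTwoToOne {f = f} {e} additive e≢𝟎 fe≡𝟎 kernel z with ∃?-𝔽 (λ y → f y ≟ z)
... | no empty = inj₁ ([] , [] , refl , λ x → mk⇔ (λ ()) (λ fx≡z → ⊥-elim (empty (x , fx≡z))))
... | yes (y , fy≡z) = inj₂ (y ∷ y ⊕ e ∷ [] , ((y≢y⊕e All.∷ All.[]) ∷ All.[] ∷ []) , refl ,
                             λ x → mk⇔ (into x) (onto x))
  where
  y≢y⊕e : y ≢ y ⊕ e
  y≢y⊕e y≡y⊕e = e≢𝟎 (identityʳ-unique y e (sym y≡y⊕e))
  into : ∀ x → x ∈ y ∷ y ⊕ e ∷ [] → f x ≡ z
  into x (here refl)         = fy≡z
  into x (there (here refl)) = trans (additive y e) (trans (cong₂ _⊕_ fy≡z fe≡𝟎) (⊕-identityʳ z))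
  onto : ∀ x → f x ≡ z → x ∈ y ∷ y ⊕ e ∷ []
  onto x fx≡z with kernel (trans (additive x y) (trans (cong₂ _⊕_ fx≡z fy≡z) (⊕-self z)))
  ... | inj₁ x⊕y≡𝟎 = here (inverseˡ-unique x y x⊕y≡𝟎)
  ... | inj₂ x⊕y≡e = there (here (trans (x≈z//y x y e x⊕y≡e) (⊕-comm e y)))

record AdditiveGraph (R : 𝔽 n → 𝔽 n → Set) : Set where
  field
    fun      : 𝔽 n → 𝔽 n
    additive : IsAdditive fun
    graph    : ∀ {x y} → R x y ⇔ fun x ≡ y

additiveGraph : {R : 𝔽 n → 𝔽 n → Set} → HasSize (uncurry R) (2 ^ n) →
  (∀ {x y x′ y′} → R x y → R x′ y′ → R (x ⊕ x′) (y ⊕ y′)) →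
  (∀ {x y y′} → R x y → R x y′ → y ≡ y′) → AdditiveGraph R
additiveGraph {n} {R} size closed functional = record
  { fun      = f
  ; additive = additive
  ; graph    = λ {x} → mk⇔ (functional (R-f x)) (λ fx≡y → subst (R x) fx≡y (R-f x)) }
  where
  same-column : ∀ {p p′} → uncurry R p → uncurry R p′ → proj₁ p ≡ proj₁ p′ → p ≡ p′
  same-column {x , _} Rxy Rxy′ refl = cong (x ,_) (functional Rxy Rxy′)
  column : ∀ x → ∃ λ p → uncurry R p × proj₁ p ≡ x
  column = injectiveOn⇒surjective _≟_ (𝔽-size n) size proj₁ same-column
  f : 𝔽 n → 𝔽 n
  f x = proj₂ (proj₁ (column x))
  R-f : ∀ x → R x (f x)
  R-f x with column x
  ... | (x , y) , Rxy , refl = Rxy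
  additive : IsAdditive f
  additive x x′ = functional (R-f (x ⊕ x′)) (closed (R-f x) (R-f x′))

aff-injective : {x x′ y y′ : 𝔽 n} → aff x y ≡ aff x′ y′ → x ≡ x′ × y ≡ y′
aff-injective refl = refl , refl

origin≢ : {x y : 𝔽 n} → y ≢ 𝟎 → aff 𝟎 𝟎 ≢ aff x y
origin≢ y≢𝟎 eq = y≢𝟎 (sym (proj₂ (aff-injective eq)))

inf-injective : {c c′ : Maybe (𝔽 n)} → _≡_ {A = Point n} (inf c) (inf c′) → c ≡ c′
inf-injective refl = refl

_≟ₚ_ : DecidableEquality (Point n)
aff x y ≟ₚ aff x′ y′ = map′ (λ (x≡x′ , y≡y′) → cong₂ aff x≡x′ y≡y′) aff-injective ((x ≟ x′) ×-dec (y ≟ y′))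
aff _ _ ≟ₚ inf _     = no λ ()
inf _   ≟ₚ aff _ _   = no λ ()
inf c   ≟ₚ inf c′    = map′ (cong inf) inf-injective (≡-dec-Maybe _≟_ c c′)

shift : 𝔽 n → Maybe (𝔽 n) → Maybe (𝔽 n)
shift s = Maybe.map (_⊕ s)

shift-involutive : (s : 𝔽 n) → Involutive _≡_ (shift s)
shift-involutive s nothing  = refl
shift-involutive s (just c) = cong just (x⊕y⊕y≡x c s)

module _ {n : ℕ} {_⋆_ : 𝔽 n → 𝔽 n → 𝔽 n} (S : IsPresemifield _⋆_) where
  open IsPresemifield S
  open Plane _⋆_

  ⋆-zeroʳ : ∀ x → x ⋆ 𝟎 ≡ 𝟎
  ⋆-zeroʳ x = additive-𝟎 (distribˡ x)

  ⋆-zeroˡ : ∀ x → 𝟎 ⋆ x ≡ 𝟎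
  ⋆-zeroˡ x = additive-𝟎 (λ y z → distribʳ x y z)

  ⋆-solvableˡ : ∀ {x} → x ≢ 𝟎 → ∀ y → ∃ λ m → x ⋆ m ≡ y
  ⋆-solvableˡ {x} x≢𝟎 = injective⇒surjective (x ⋆_) (additive-injective (distribˡ x) trivial-kernel)
    where
    trivial-kernel : ∀ {m} → x ⋆ m ≡ 𝟎 → m ≡ 𝟎
    trivial-kernel {m} xm≡𝟎 = [ ⊥-elim ∘ x≢𝟎 , id ]′ (noZeroDivisors x m xm≡𝟎)

  on-horizontal : ∀ x c → aff x c on line 𝟎 c
  on-horizontal x c = sym (trans (cong (_⊕ c) (⋆-zeroʳ x)) (⊕-identityˡ c))

  on-line-through-origin : ∀ m → aff 𝟎 𝟎 on line m 𝟎
  on-line-through-origin m = sym (trans (⊕-identityʳ (𝟎 ⋆ m)) (⋆-zeroˡ m))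

  involution : (f : Point n → Point n) (h : Line n → Line n) →
    Involutive _≡_ f → Involutive _≡_ h → (∀ {p l} → p on l → f p on h l) → Collineation
  involution f h f-inv h-inv f-on = record
    { pt = f ; ptInv = f ; pt-inv₁ = f-inv ; pt-inv₂ = f-inv
    ; ln = h ; lnInv = h ; ln-inv₁ = h-inv ; ln-inv₂ = h-inv
    ; preserves = λ p l → mk⇔ f-on (subst₂ _on_ (f-inv p) (h-inv l) ∘ f-on) }

  infixr 9 _∘ᶜ_
  _∘ᶜ_ : Collineation → Collineation → Collineation
  g ∘ᶜ g′ = record
    { pt = G.pt ∘ G′.pt ; ptInv = G′.ptInv ∘ G.ptInv
    ; pt-inv₁ = λ p → trans (cong G.pt (G′.pt-inv₁ (G.ptInv p))) (G.pt-inv₁ p)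
    ; pt-inv₂ = λ p → trans (cong G′.ptInv (G.pt-inv₂ (G′.pt p))) (G′.pt-inv₂ p)
    ; ln = G.ln ∘ G′.ln ; lnInv = G′.lnInv ∘ G.lnInv
    ; ln-inv₁ = λ l → trans (cong G.ln (G′.ln-inv₁ (G.lnInv l))) (G.ln-inv₁ l)
    ; ln-inv₂ = λ l → trans (cong G′.lnInv (G.ln-inv₂ (G′.ln l))) (G′.ln-inv₂ l)
    ; preserves = λ p l → mk⇔ (to (G.preserves _ _) ∘ to (G′.preserves p l))
                                (from (G′.preserves p l) ∘ from (G.preserves _ _)) }
    where
    module G = Collineation g
    module G′ = Collineation g′

  translateLine : Translation → Line n → Line n
  translateLine _       lInf       = lInf
  translateLine (a , _) (vert c)   = vert (c ⊕ a)
  translateLine (a , b) (line m c) = line m (c ⊕ (a ⋆ m ⊕ b))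

  translation : Translation → Collineation
  translation (a , b) = involution (translate (a , b)) (translateLine (a , b)) point-inv line-inv on
    where
    point-inv : Involutive _≡_ (translate (a , b))
    point-inv (aff x y) = cong₂ aff (x⊕y⊕y≡x x a) (x⊕y⊕y≡x y b)
    point-inv (inf c)   = refl
    line-inv : Involutive _≡_ (translateLine (a , b))
    line-inv lInf       = refl
    line-inv (vert c)   = cong vert (x⊕y⊕y≡x c a)
    line-inv (line m c) = cong (line m) (x⊕y⊕y≡x c (a ⋆ m ⊕ b))
    on : ∀ {p l} → p on l → translate (a , b) p on translateLine (a , b) l
    on {aff x y}       {vert c}   x≡c = cong (_⊕ a) x≡c
    on {aff x y}       {line m c} refl = begin
      x ⋆ m ⊕ c ⊕ b                          ≡⟨ cong (x ⋆ m ⊕ c ⊕_) (x⊕[x⊕y]≡y (a ⋆ m) b) ⟨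
      x ⋆ m ⊕ c ⊕ (a ⋆ m ⊕ (a ⋆ m ⊕ b))     ≡⟨ interchange (x ⋆ m) c (a ⋆ m) (a ⋆ m ⊕ b) ⟩
      x ⋆ m ⊕ a ⋆ m ⊕ (c ⊕ (a ⋆ m ⊕ b))     ≡⟨ cong (_⊕ (c ⊕ (a ⋆ m ⊕ b))) (distribʳ m x a) ⟨
      (x ⊕ a) ⋆ m ⊕ (c ⊕ (a ⋆ m ⊕ b))       ∎
      where open ≡-Reasoning
    on {inf _}         {lInf}     _   = tt
    on {inf nothing}   {vert _}   _   = tt
    on {inf (just _)}  {line _ _} c≡m = c≡m

  shearPoint : 𝔽 n → Point n → Point n
  shearPoint s (aff x y) = aff x (y ⊕ x ⋆ s)
  shearPoint s (inf c)   = inf (shift s c)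

  shearLine : 𝔽 n → Line n → Line n
  shearLine s lInf       = lInf
  shearLine s (vert c)   = vert c
  shearLine s (line m c) = line (m ⊕ s) c

  shear : 𝔽 n → Collineation
  shear s = involution (shearPoint s) (shearLine s) point-inv line-inv on
    where
    point-inv : Involutive _≡_ (shearPoint s)
    point-inv (aff x y) = cong (aff x) (x⊕y⊕y≡x y (x ⋆ s))
    point-inv (inf c)   = cong inf (shift-involutive s c)
    line-inv : Involutive _≡_ (shearLine s)
    line-inv lInf       = refl
    line-inv (vert c)   = refl
    line-inv (line m c) = cong (λ m′ → line m′ c) (x⊕y⊕y≡x m s)
    on : ∀ {p l} → p on l → shearPoint s p on shearLine s l
    on {aff x y}      {vert c}   x≡c  = x≡c
    on {aff x y}      {line m c} refl = begin
      x ⋆ m ⊕ c ⊕ x ⋆ s     ≡⟨ xy∙z≈xz∙y (x ⋆ m) c (x ⋆ s) ⟩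
      x ⋆ m ⊕ x ⋆ s ⊕ c     ≡⟨ cong (_⊕ c) (distribˡ x m s) ⟨
      x ⋆ (m ⊕ s) ⊕ c       ∎
      where open ≡-Reasoning
    on {inf _}        {lInf}     _   = tt
    on {inf nothing}  {vert _}   _   = tt
    on {inf (just _)} {line _ _} c≡m = cong (_⊕ s) c≡m

  NoThreeCollinear : PointSet → Set
  NoThreeCollinear O = ∀ l p₁ p₂ p₃ → O p₁ → O p₂ → O p₃ → p₁ on l → p₂ on l → p₃ on l →
    p₁ ≢ p₂ → p₁ ≢ p₃ → p₂ ≢ p₃ → ⊥

  image-noThreeCollinear : ∀ g {O} → NoThreeCollinear O → NoThreeCollinear (image g O)
  image-noThreeCollinear g noThree l p₁ p₂ p₃ O₁ O₂ O₃ on₁ on₂ on₃ p₁≢p₂ p₁≢p₃ p₂≢p₃ =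
    noThree (lnInv l) (ptInv p₁) (ptInv p₂) (ptInv p₃) O₁ O₂ O₃ (back on₁) (back on₂) (back on₃)
      (ptInv-≢ p₁≢p₂) (ptInv-≢ p₁≢p₃) (ptInv-≢ p₂≢p₃)
    where
    open Collineation g
    back : ∀ {p} → p on l → ptInv p on lnInv l
    back {p} p∈l = from (preserves (ptInv p) (lnInv l)) (subst₂ _on_ (sym (pt-inv₁ p)) (sym (ln-inv₁ l)) p∈l)
    ptInv-≢ : ∀ {p p′} → p ≢ p′ → ptInv p ≢ ptInv p′
    ptInv-≢ {p} {p′} p≢p′ eq = p≢p′ (trans (sym (pt-inv₁ p)) (trans (cong pt eq) (pt-inv₁ p′)))

  collinear⇒≡ : ∀ {O p p′ r} → NoThreeCollinear O → ∀ l → O p → O p′ → O r →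
    p on l → p′ on l → r on l → r ≢ p → r ≢ p′ → p ≡ p′
  collinear⇒≡ {p = p} {p′} {r} noThree l Op Op′ Or p∈l p′∈l r∈l r≢p r≢p′ with p ≟ₚ p′
  ... | yes p≡p′ = p≡p′
  ... | no p≢p′  = ⊥-elim (noThree l p p′ r Op Op′ Or p∈l p′∈l r∈l p≢p′ (≢-sym r≢p) (≢-sym r≢p′))

  record IsNormalHyperoval (ω : Maybe (𝔽 n)) (O : PointSet) : Set where
    field
      noThreeCollinear : NoThreeCollinear O
      affine-size      : HasSize (uncurry λ x y → O (aff x y)) (2 ^ n)
      affine-closed    : ∀ {x y x′ y′} → O (aff x y) → O (aff x′ y′) → O (aff (x ⊕ x′) (y ⊕ y′))
      origin           : O (aff 𝟎 𝟎)
      zero∈O           : O (inf (just 𝟎))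
      ω∈O              : O (inf ω)
      ω≢𝟎              : ω ≢ just 𝟎
      at-infinity      : ∀ {c} → O (inf c) → c ≡ just 𝟎 ⊎ c ≡ ω

  module _ {O : PointSet} where

    record SecantAtInfinity : Set where
      field
        a    : 𝔽 n
        u    : Maybe (𝔽 n)
        u≢a  : u ≢ just a
        Oa   : O (inf (just a))
        Ou   : O (inf u)
        only : ∀ {c} → O (inf c) → c ≡ just a ⊎ c ≡ u

    pointsAtInfinity : IsSecant O lInf → SecantAtInfinity
    pointsAtInfinity ([] , _ , () , _)
    pointsAtInfinity (_ ∷ [] , _ , () , _)
    pointsAtInfinity (_ ∷ _ ∷ _ ∷ _ , _ , () , _)
    pointsAtInfinity (p₁ ∷ p₂ ∷ [] , (p₁≢p₂ All.∷ All.[]) ∷ _ , refl , mem) =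
      pair p₁ p₂ p₁≢p₂ (to (mem p₁) (here refl)) (to (mem p₂) (there (here refl))) only
      where
      only : ∀ {c} → O (inf c) → inf c ≡ p₁ ⊎ inf c ≡ p₂
      only {c} Oc with from (mem (inf c)) (Oc , tt)
      ... | here c≡p₁         = inj₁ c≡p₁
      ... | there (here c≡p₂) = inj₂ c≡p₂
      pair : ∀ p q → p ≢ q → O p × p on lInf → O q × q on lInf →
        (∀ {c} → O (inf c) → inf c ≡ p ⊎ inf c ≡ q) → SecantAtInfinity
      pair (aff _ _) _ _ (_ , ()) _ _
      pair (inf _) (aff _ _) _ _ (_ , ()) _
      pair (inf nothing) (inf nothing) p≢q _ _ _ = ⊥-elim (p≢q refl)
      pair (inf u) (inf (just a)) p≢q (Ou , _) (Oa , _) only′ =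
        record { u≢a = p≢q ∘ cong inf ; Oa = Oa ; Ou = Ou
               ; only = λ Oc → [ inj₂ ∘ inf-injective , inj₁ ∘ inf-injective ]′ (only′ Oc) }
      pair (inf (just a)) (inf nothing) p≢q (Oa , _) (Ou , _) only′ =
        record { u≢a = λ () ; Oa = Oa ; Ou = Ou
               ; only = λ Oc → [ inj₁ ∘ inf-injective , inj₂ ∘ inf-injective ]′ (only′ Oc) }

    affinePoint : ∀ {a u} → HasSize O (2 ^ n + 2) →
      (∀ {c} → O (inf c) → c ≡ just a ⊎ c ≡ u) → ∃₂ λ x y → O (aff x y)
    affinePoint {a} {u} (xs , unique , xs-length , mem) only with any? isAffine? xs
      where
      isAffine? : Decidable λ p → ∃₂ λ x y → p ≡ aff x y
      isAffine? (aff x y) = yes (x , y , refl)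
      isAffine? (inf _)   = no λ ()
    ... | yes hit = let p , p∈xs , x , y , p≡aff = find hit in x , y , subst O p≡aff (to (mem p) p∈xs)
    ... | no none = contradiction (injectiveOn⇒length≤ id unique (λ _ _ → id) into) (<⇒≱ 2<length)
      where
      into : ∀ {p} → p ∈ xs → p ∈ inf (just a) ∷ inf u ∷ []
      into {aff x y} p∈xs = ⊥-elim (none (lose p∈xs (x , y , refl)))
      into {inf c}   p∈xs = [ here ∘ cong inf , there ∘ here ∘ cong inf ]′ (only (to (mem (inf c)) p∈xs))
      2<length : 2 + 1 ≤ length xs
      2<length = subst (3 ≤_) (sym xs-length) (+-monoˡ-≤ 2 (m^n>0 2 n))

  module AffinePart {O : PointSet} {T : Translation → Set} (subgroup : IsTranslationSubgroupOfOrderQ T)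
    (acts : ActsRegularlyOnAffine T O) (p₀ : ∃₂ λ x₀ y₀ → O (aff x₀ y₀)) (s : 𝔽 n) where
    open IsTranslationSubgroupOfOrderQ subgroup

    x₀ y₀ : 𝔽 n
    x₀ = proj₁ p₀
    y₀ = proj₁ (proj₂ p₀)

    translationGroup≐affinePart : ∀ x z → T (x , z) ⇔ O (translate (x₀ , y₀) (aff x z))
    translationGroup≐affinePart x z = mk⇔ into onto
      where
      into : T (x , z) → O (aff (x ⊕ x₀) (z ⊕ y₀))
      into Txz = subst₂ (λ x′ z′ → O (aff x′ z′)) (⊕-comm x₀ x) (⊕-comm y₀ z)
                   (proj₁ acts (x , z) x₀ y₀ Txz (proj₂ (proj₂ p₀)))
      solve : ∀ c t w → c ⊕ t ≡ w ⊕ c → t ≡ w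
      solve c t w eq = ∙-cancelˡ c t w (trans eq (⊕-comm w c))
      onto : O (aff (x ⊕ x₀) (z ⊕ y₀)) → T (x , z)
      onto O₁ with proj₂ acts x₀ y₀ (x ⊕ x₀) (z ⊕ y₀) (proj₂ (proj₂ p₀)) O₁
      ... | (t₁ , t₂) , Tt , t·p₀≡p₁ , _ =
        subst T (cong₂ _,_ (solve x₀ t₁ x (proj₁ (aff-injective t·p₀≡p₁)))
                           (solve y₀ t₂ z (proj₂ (aff-injective t·p₀≡p₁)))) Tt

    g : Collineation
    g = shear s ∘ᶜ translation (x₀ , y₀)

    O′ : PointSet
    O′ = image g O

    T⇔O′ : ∀ x z → T (x , z) ⇔ O′ (aff x (z ⊕ x ⋆ s))
    T⇔O′ x z = subst (λ z′ → T (x , z) ⇔ O (translate (x₀ , y₀) (aff x z′))) (sym (x⊕y⊕y≡x z (x ⋆ s)))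
                 (translationGroup≐affinePart x z)

    O′→T : ∀ {x y} → O′ (aff x y) → T (x , y ⊕ x ⋆ s)
    O′→T {x} {y} = from (translationGroup≐affinePart x (y ⊕ x ⋆ s))

    affine-size : HasSize (uncurry λ x y → O′ (aff x y)) (2 ^ n)
    affine-size = HasSize-↔ (mk↔ₛ′ shearPair shearPair shearPair-inv shearPair-inv) (uncurry T⇔O′) order
      where
      shearPair : 𝔽 n × 𝔽 n → 𝔽 n × 𝔽 n
      shearPair (x , z) = x , z ⊕ x ⋆ s
      shearPair-inv : Involutive _≡_ shearPair
      shearPair-inv (x , z) = cong (x ,_) (x⊕y⊕y≡x z (x ⋆ s))

    affine-closed : ∀ {x y x′ y′} → O′ (aff x y) → O′ (aff x′ y′) → O′ (aff (x ⊕ x′) (y ⊕ y′))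
    affine-closed {x} {y} {x′} {y′} O′xy O′x′y′ =
      subst (λ z → O′ (aff (x ⊕ x′) z)) (x⊕y⊕y≡x (y ⊕ y′) ((x ⊕ x′) ⋆ s))
        (to (T⇔O′ (x ⊕ x′) _) (subst (λ z → T (x ⊕ x′ , z)) sum≡ (closed _ _ (O′→T O′xy) (O′→T O′x′y′))))
      where
      sum≡ : y ⊕ x ⋆ s ⊕ (y′ ⊕ x′ ⋆ s) ≡ y ⊕ y′ ⊕ (x ⊕ x′) ⋆ s
      sum≡ = trans (interchange y (x ⋆ s) y′ (x′ ⋆ s)) (cong (y ⊕ y′ ⊕_) (sym (distribʳ s x x′)))

    origin : O′ (aff 𝟎 𝟎)
    origin = subst (λ y → O′ (aff 𝟎 y)) (trans (⊕-identityˡ (𝟎 ⋆ s)) (⋆-zeroˡ s)) (to (T⇔O′ 𝟎 𝟎) hasZero)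

  normalise : ∀ {O} → IsTranslationHyperoval O →
    Σ Collineation λ g → Σ (Maybe (𝔽 n)) λ ω → IsNormalHyperoval ω (image g O)
  normalise {O} ((size , noThree) , secant , T , subgroup , acts) =
    g , shift a u , record
      { noThreeCollinear = image-noThreeCollinear g noThree
      ; affine-size      = affine-size
      ; affine-closed    = affine-closed
      ; origin           = origin
      ; zero∈O           = subst (λ c → O (inf (just c))) (sym (⊕-identityˡ a)) Oa
      ; ω∈O              = subst (O ∘ inf) (sym (shift-involutive a u)) Ou
      ; ω≢𝟎              = λ ω≡𝟎 → u≢a (trans (sym (shift-involutive a u))
                                             (trans (cong (shift a) ω≡𝟎) (cong just (⊕-identityˡ a))))
      ; at-infinity      = at-infinity }
    where
    open SecantAtInfinity (pointsAtInfinity secant)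
    open AffinePart {O = O} subgroup acts (affinePoint size only) a
    at-infinity : ∀ {c} → O′ (inf c) → c ≡ just 𝟎 ⊎ c ≡ shift a u
    at-infinity {c} O′c with only O′c
    ... | inj₁ c+a≡a = inj₁ (trans (sym (shift-involutive a c)) (trans (cong (shift a) c+a≡a) (cong just (⊕-self a))))
    ... | inj₂ c+a≡u = inj₂ (trans (sym (shift-involutive a c)) (cong (shift a) c+a≡u))

  Curve : (𝔽 n → 𝔽 n × 𝔽 n) → PointSet
  Curve γ p = ∃ λ t → p ≡ uncurry aff (γ t)

  ≐-curve : ∀ {ω O} → IsNormalHyperoval ω O → (γ : 𝔽 n → 𝔽 n × 𝔽 n) →
    (∀ t → O (uncurry aff (γ t))) → (∀ {x y} → O (aff x y) → Curve γ (aff x y)) →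
    O ≐ λ p → Curve γ p ⊎ p ≡ inf (just 𝟎) ⊎ p ≡ inf ω
  ≐-curve {O = O} N γ on-curve covered (aff x y) = mk⇔ (inj₁ ∘ covered) λ where
    (inj₁ (t , p≡γt)) → subst O (sym p≡γt) (on-curve t)
    (inj₂ (inj₁ ()))
    (inj₂ (inj₂ ()))
  ≐-curve N γ on-curve covered (inf c) =
    mk⇔ (λ Oc → inj₂ (Sum.map (cong inf) (cong inf) (at-infinity Oc))) λ where
      (inj₁ (_ , ()))
      (inj₂ (inj₁ refl)) → zero∈O
      (inj₂ (inj₂ refl)) → ω∈O
    where open IsNormalHyperoval N

  normalFormA : ∀ {O} → IsNormalHyperoval nothing O →
    Σ (𝔽 n → 𝔽 n) λ f → IsAdditive f × IsPermutation f × f 𝟎 ≡ 𝟎 × O ≐ FormA f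
  normalFormA {O} N =
    f , additive , injective⇒IsPermutation (additive-injective additive trivial-kernel) , additive-𝟎 additive ,
    ≐-curve N (λ x → x , f x) (λ x → from graph refl) (λ {x} Oxy → x , cong (aff x) (sym (to graph Oxy)))
    where
    open IsNormalHyperoval N
    vertical : ∀ {x y y′} → O (aff x y) → O (aff x y′) → y ≡ y′
    vertical Oxy Oxy′ = proj₂ (aff-injective
      (collinear⇒≡ noThreeCollinear (vert _) Oxy Oxy′ ω∈O refl refl tt (λ ()) (λ ())))
    open AdditiveGraph (additiveGraph affine-size affine-closed vertical) renaming (fun to f)
    trivial-kernel : ∀ {x} → f x ≡ 𝟎 → x ≡ 𝟎
    trivial-kernel {x} fx≡𝟎 = proj₁ (aff-injective
      (collinear⇒≡ noThreeCollinear (line 𝟎 𝟎) (from graph fx≡𝟎) origin zero∈O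
        (on-horizontal x 𝟎) (on-horizontal 𝟎 𝟎) refl (λ ()) (λ ())))

  module NormalFormB {O : PointSet} {α : 𝔽 n} (N : IsNormalHyperoval (just α) O) where
    open IsNormalHyperoval N

    α≢𝟎 : α ≢ 𝟎
    α≢𝟎 = ω≢𝟎 ∘ cong just

    horizontal : ∀ {y x x′} → O (aff x y) → O (aff x′ y) → x ≡ x′
    horizontal {y} {x} {x′} Oxy Ox′y = proj₁ (aff-injective
      (collinear⇒≡ noThreeCollinear (line 𝟎 y) Oxy Ox′y zero∈O
        (on-horizontal x y) (on-horizontal x′ y) refl (λ ()) (λ ())))

    open AdditiveGraph (additiveGraph {R = λ y x → O (aff x y)}
      (HasSize-↔ (×-comm _ _) (λ _ → mk⇔ id id) affine-size) affine-closed horizontal)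
      renaming (fun to k) public

    on-graph : ∀ y → O (aff (k y) y)
    on-graph y = from graph refl

    -- If k had trivial kernel, the q - 1 points (k y, y) with y ≠ 0 would lie on distinct lines
    -- through the origin, none of them vertical, nor of slope 0 or α since (0), (α) ∈ O:
    -- only q - 2 slopes remain.
    module Slopes (trivial-kernel : ∀ {y} → k y ≡ 𝟎 → y ≡ 𝟎) where
      slope-of : ∀ {y} → y ≢ 𝟎 → ∃ λ m → k y ⋆ m ≡ y
      slope-of {y} y≢𝟎 = ⋆-solvableˡ (y≢𝟎 ∘ trivial-kernel) y

      slope : ∀ {y} → y ≢ 𝟎 → 𝔽 n
      slope y≢𝟎 = proj₁ (slope-of y≢𝟎)

      on-slope : ∀ {y} (y≢𝟎 : y ≢ 𝟎) → aff (k y) y on line (slope y≢𝟎) 𝟎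
      on-slope y≢𝟎 = sym (trans (⊕-identityʳ _) (proj₂ (slope-of y≢𝟎)))

      slope≢𝟎 : ∀ {y} (y≢𝟎 : y ≢ 𝟎) → slope y≢𝟎 ≢ 𝟎
      slope≢𝟎 {y} y≢𝟎 m≡𝟎 = y≢𝟎 (begin
        y                       ≡⟨ on-slope y≢𝟎 ⟩
        k y ⋆ slope y≢𝟎 ⊕ 𝟎     ≡⟨ cong (λ m → k y ⋆ m ⊕ 𝟎) m≡𝟎 ⟩
        k y ⋆ 𝟎 ⊕ 𝟎             ≡⟨ ⊕-identityʳ _ ⟩
        k y ⋆ 𝟎                 ≡⟨ ⋆-zeroʳ (k y) ⟩
        𝟎                       ∎)
        where open ≡-Reasoning

      slope≢α : ∀ {y} (y≢𝟎 : y ≢ 𝟎) → slope y≢𝟎 ≢ α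
      slope≢α {y} y≢𝟎 m≡α = origin≢ y≢𝟎 (sym
        (collinear⇒≡ noThreeCollinear (line α 𝟎) (on-graph y) origin ω∈O
          (subst (λ m → aff (k y) y on line m 𝟎) m≡α (on-slope y≢𝟎)) (on-line-through-origin α) refl
          (λ ()) (λ ())))

      slope-injective : ∀ {y y′} (y≢𝟎 : y ≢ 𝟎) (y′≢𝟎 : y′ ≢ 𝟎) → slope y≢𝟎 ≡ slope y′≢𝟎 → y ≡ y′
      slope-injective {y} {y′} y≢𝟎 y′≢𝟎 m≡m′ = proj₂ (aff-injective
        (collinear⇒≡ noThreeCollinear (line (slope y≢𝟎) 𝟎) (on-graph y) (on-graph y′) origin (on-slope y≢𝟎)
          (subst (λ m → aff (k y′) y′ on line m 𝟎) (sym m≡m′) (on-slope y′≢𝟎))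
          (on-line-through-origin _) (origin≢ y≢𝟎) (origin≢ y′≢𝟎)))

      σ : 𝔽 n → 𝔽 n
      σ y with y ≟ 𝟎
      ... | yes _   = 𝟎
      ... | no y≢𝟎 = slope y≢𝟎

      σ-injective : ∀ {y y′} → σ y ≡ σ y′ → y ≡ y′
      σ-injective {y} {y′} σy≡σy′ with y ≟ 𝟎 | y′ ≟ 𝟎
      ... | yes y≡𝟎 | yes y′≡𝟎 = trans y≡𝟎 (sym y′≡𝟎)
      ... | yes _   | no y′≢𝟎  = ⊥-elim (slope≢𝟎 y′≢𝟎 (sym σy≡σy′))
      ... | no y≢𝟎  | yes _    = ⊥-elim (slope≢𝟎 y≢𝟎 σy≡σy′)
      ... | no y≢𝟎  | no y′≢𝟎  = slope-injective y≢𝟎 y′≢𝟎 σy≡σy′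

      σ≢α : ∀ y → σ y ≢ α
      σ≢α y with y ≟ 𝟎
      ... | yes _   = α≢𝟎 ∘ sym
      ... | no y≢𝟎 = slope≢α y≢𝟎

    slopes-exhausted : (∀ {y} → k y ≡ 𝟎 → y ≡ 𝟎) → ⊥
    slopes-exhausted trivial-kernel = let y , σy≡α = injective⇒surjective σ σ-injective α in σ≢α y σy≡α
      where open Slopes trivial-kernel

    kernel-nontrivial : ∃ λ e → e ≢ 𝟎 × k e ≡ 𝟎
    kernel-nontrivial with ∃?-𝔽 (λ e → ¬? (e ≟ 𝟎) ×-dec (k e ≟ 𝟎))
    ... | yes nontrivial = nontrivial
    ... | no trivial = ⊥-elim (slopes-exhausted (λ {y} ky≡𝟎 →
                         decidable-stable (y ≟ 𝟎) (λ y≢𝟎 → trivial (y , y≢𝟎 , ky≡𝟎))))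

    kernel-atMostTwo : ∀ {e w} → e ≢ 𝟎 → k e ≡ 𝟎 → k w ≡ 𝟎 → w ≡ 𝟎 ⊎ w ≡ e
    kernel-atMostTwo {w = w} e≢𝟎 ke≡𝟎 kw≡𝟎 with w ≟ 𝟎
    ... | yes w≡𝟎 = inj₁ w≡𝟎
    ... | no w≢𝟎  = inj₂ (sym (proj₂ (aff-injective
      (collinear⇒≡ noThreeCollinear (vert 𝟎) (from graph ke≡𝟎) (from graph kw≡𝟎) origin refl refl refl
        (origin≢ e≢𝟎) (origin≢ w≢𝟎)))))

  normalFormB : ∀ {O α} → IsNormalHyperoval (just α) O →
    Σ (𝔽 n → 𝔽 n) λ k → α ≢ 𝟎 × IsAdditive k × IsTwoToOne k × k 𝟎 ≡ 𝟎 × O ≐ FormB k α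
  normalFormB N =
    let e , e≢𝟎 , ke≡𝟎 = kernel-nontrivial in
    k , α≢𝟎 , additive , additive-kernel₂⇒IsTwoToOne additive e≢𝟎 ke≡𝟎 (kernel-atMostTwo e≢𝟎 ke≡𝟎) ,
    additive-𝟎 additive ,
    ≐-curve N (λ y → k y , y) on-graph (λ {y = y} Oxy → y , cong (λ x′ → aff x′ y) (sym (to graph Oxy)))
    where open NormalFormB N

-- The argument works for every n.
proposition2p3 : (n : ℕ) → 1 ≤ n →
    (_⋆_ : 𝔽 n → 𝔽 n → 𝔽 n) → IsPresemifield _⋆_ →
    (O : Plane.PointSet _⋆_) → Plane.IsTranslationHyperoval _⋆_ O →
    Σ (Plane.Collineation _⋆_) λ g →
      (Σ (𝔽 n → 𝔽 n) λ f →
         IsAdditive f × IsPermutation f × f 𝟎 ≡ 𝟎 ×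
         Plane._≐_ _⋆_ (Plane.image _⋆_ g O) (FormA f))
      ⊎
      (Σ (𝔽 n) λ α → Σ (𝔽 n → 𝔽 n) λ f →
         ¬ α ≡ 𝟎 × IsAdditive f × IsTwoToOne f × f 𝟎 ≡ 𝟎 ×
         Plane._≐_ _⋆_ (Plane.image _⋆_ g O) (FormB f α))
proposition2p3 n _ _⋆_ S O hyp with normalise S hyp
... | g , nothing , N = g , inj₁ (normalFormA S N)
... | g , just α  , N = g , inj₂ (α , normalFormB S N)
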